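{- Let $M$ be a copy of $K_{2,3}$ with parts $\{v,w\}$ and $\{u_1,u_2,u_3\}$ (i.e. the three paths $vu_iw$, $i\in\{1,2,3\}$), and let $c$ be a proper edge-coloring of $M$ under which $M$ contains no rainbow path on $5$ vertices. Then either (1) $c$ uses exactly four colors and there are distinct $i,j\in\{1,2,3\}$ with $c(vu_i)=c(wu_j)$ and $c(vu_j)=c(wu_i)$; or (2) $c$ uses exactly three colors and $c(vu_i)\in\{c(wu_1),c(wu_2),c(wu_3)\}$ for every $i\in\{1,2,3\}$.
   Context: An edge-coloring is proper if no two edges sharing a vertex receive the same color. A path is rainbow if all its edges receive distinct colors. -}

module Defs where

open import Data.Nat using (ℕ; _≟_)
open import Data.Fin using (Fin; zero; suc; inject₁)
open import Data.List using (List; _∷_; []; length; map; deduplicate)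
open import Data.Product using (Σ; _×_; _,_)
open import Relation.Binary.PropositionalEquality using (_≡_; _≢_)
open import Function.Definitions using (Injective)

data Vertex : Set where
  v w : Vertex
  u   : Fin 3 → Vertex

data Edge : Set where
  vu wu : Fin 3 → Edge

data Joins : Edge → Vertex → Vertex → Set where
  vu-vu : ∀ i → Joins (vu i) v (u i)
  vu-uv : ∀ i → Joins (vu i) (u i) v
  wu-wu : ∀ i → Joins (wu i) w (u i)
  wu-uw : ∀ i → Joins (wu i) (u i) w

Coloring : Set
Coloring = Edge → ℕ

data ShareVertex : Edge → Edge → Set where
  at-v : ∀ {i j} → i ≢ j → ShareVertex (vu i) (vu j)
  at-w : ∀ {i j} → i ≢ j → ShareVertex (wu i) (wu j)
  at-u₁ : ∀ i → ShareVertex (vu i) (wu i)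
  at-u₂ : ∀ i → ShareVertex (wu i) (vu i)

Proper : Coloring → Set
Proper c = ∀ e f → ShareVertex e f → c e ≢ c f

record Path5 : Set where
  field
    x : Fin 5 → Vertex
    x-inj : Injective _≡_ _≡_ x
    e : Fin 4 → Edge
    joins : ∀ k → Joins (e k) (x (inject₁ k)) (x (suc k))

Rainbow : Coloring → Path5 → Set
Rainbow c P = Injective _≡_ _≡_ (λ k → c (Path5.e P k))

allEdges : List Edge
allEdges = vu zero ∷ vu (suc zero) ∷ vu (suc (suc zero))
         ∷ wu zero ∷ wu (suc zero) ∷ wu (suc (suc zero)) ∷ []

numColors : Coloring → ℕ
numColors c = length (deduplicate _≟_ (map c allEdges))

-- Write aᵢ = c(vuᵢ) and bⱼ = c(wuⱼ). For pairwise distinct i, j, k the path uᵢ v uⱼ w uₖ has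
-- colours aᵢ, aⱼ, bⱼ, bₖ; properness already separates all of them except aᵢ/bⱼ, aᵢ/bₖ, aⱼ/bₖ,
-- so without rainbow paths one of these three equalities holds. Call i unmatched if aᵢ is none
-- of the bⱼ. If k is unmatched, the paths uₖ v uᵢ w uⱼ and uₖ v uⱼ w uᵢ force aᵢ = bⱼ and
-- aⱼ = bᵢ. Hence either every index is matched and the colours are exactly b₁, b₂, b₃, or a
-- single index is unmatched, which adds one colour and leaves the other two swapped.
module Submission where

open import Defs
open import Data.Empty using (⊥-elim)
open import Data.Fin as Fin using (Fin; zero; suc; inject₁)
open import Data.Fin.Patterns using (0F; 1F; 2F; 3F; 4F)
open import Data.Fin.Properties using (all?; any?; ¬∀⟶∃¬)
open import Data.List using (List; _∷_; []; length; map; filter; deduplicate; allFin)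
open import Data.List.Properties using (filter-all; filter-accept; filter-reject)
open import Data.List.Membership.Propositional using (_∈_; _∉_)
open import Data.List.Membership.Propositional.Properties
  using (∈-map⁺; ∈-map⁻; ∈-allFin; ∈-deduplicate⁺; ∈-deduplicate⁻)
open import Data.List.Relation.Unary.Any using (here; there)
open import Data.List.Relation.Unary.All using (All)
open import Data.List.Relation.Unary.All.Properties using (¬Any⇒All¬; All¬⇒¬Any)
open import Data.List.Relation.Unary.AllPairs using (_∷_)
open import Data.List.Relation.Unary.Unique.Propositional using (Unique)
import Data.List.Relation.Unary.Unique.Propositional.Properties as Unique
import Data.List.Relation.Unary.Unique.DecPropositional.Properties as DecUnique
open import Data.Nat as Nat using (ℕ; _≟_)
open import Data.Product using (Σ; _×_; ∃; _,_)
open import Data.Sum using (_⊎_; inj₁; inj₂)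
open import Function using (_∘_)
open import Function.Definitions using (Injective)
open import Relation.Binary.Definitions using (DecidableEquality)
open import Relation.Binary.PropositionalEquality
  using (_≡_; _≢_; refl; sym; trans; cong; subst; module ≡-Reasoning)
open import Relation.Nullary using (¬_; Dec; yes; no; ¬?)
open import Relation.Nullary.Decidable using (decidable-stable)

module DeduplicateLength {A : Set} (_≟ᴬ_ : DecidableEquality A) where

  distinctCount : List A → ℕ
  distinctCount xs = length (deduplicate _≟ᴬ_ xs)

  private
    without : A → List A → List A
    without x = filter (¬? ∘ (x ≟ᴬ_))

    without-all≢ : ∀ {x ys} → All (x ≢_) ys → without x ys ≡ ys
    without-all≢ = filter-all (¬? ∘ (_ ≟ᴬ_))

    length-without-∈ : ∀ {x ys} → Unique ys → x ∈ ys → Nat.suc (length (without x ys)) ≡ length ys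
    length-without-∈ {ys = y ∷ ys} (y∉ys ∷ _) (here refl) =
      cong Nat.suc (cong length
        (trans (filter-reject (¬? ∘ (y ≟ᴬ_)) (λ y≢y → y≢y refl)) (without-all≢ y∉ys)))
    length-without-∈ {x} {y ∷ ys} (y∉ys ∷ !ys) (there x∈ys) =
      cong Nat.suc (trans (cong length (filter-accept (¬? ∘ (x ≟ᴬ_)) x≢y)) (length-without-∈ !ys x∈ys))
      where
      x≢y : x ≢ y
      x≢y refl = All¬⇒¬Any y∉ys x∈ys

  distinctCount-∷-∈ : ∀ {x xs} → x ∈ xs → distinctCount (x ∷ xs) ≡ distinctCount xs
  distinctCount-∷-∈ {xs = xs} x∈xs =
    length-without-∈ (DecUnique.deduplicate-! _≟ᴬ_ xs) (∈-deduplicate⁺ _≟ᴬ_ x∈xs)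

  distinctCount-∷-∉ : ∀ {x xs} → x ∉ xs → distinctCount (x ∷ xs) ≡ Nat.suc (distinctCount xs)
  distinctCount-∷-∉ {xs = xs} x∉xs =
    cong Nat.suc (cong length (without-all≢ (¬Any⇒All¬ _ (x∉xs ∘ ∈-deduplicate⁻ _≟ᴬ_ xs))))

  distinctCount-unique : ∀ {xs} → Unique xs → distinctCount xs ≡ length xs
  distinctCount-unique {[]} _ = refl
  distinctCount-unique {x ∷ xs} (x∉xs ∷ !xs) =
    trans (distinctCount-∷-∉ (All¬⇒¬Any x∉xs)) (cong Nat.suc (distinctCount-unique !xs))

open DeduplicateLength _≟_

injective-suc : ∀ {A : Set} {n} {f : Fin (Nat.suc n) → A} →
  (∀ p → f zero ≢ f (suc p)) → Injective _≡_ _≡_ (f ∘ suc) → Injective _≡_ _≡_ f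
injective-suc _ _ {zero} {zero} _ = refl
injective-suc f₀≢ _ {zero} {suc q} eq = ⊥-elim (f₀≢ q eq)
injective-suc f₀≢ _ {suc p} {zero} eq = ⊥-elim (f₀≢ p (sym eq))
injective-suc _ inj {suc p} {suc q} eq = cong suc (inj eq)

injective-fin1 : ∀ {A : Set} (f : Fin 1 → A) → Injective _≡_ _≡_ f
injective-fin1 _ {zero} {zero} _ = refl

u-injective : Injective _≡_ _≡_ u
u-injective refl = refl

zigzag : ∀ {i j k} → i ≢ j → i ≢ k → j ≢ k → Path5
zigzag {i} {j} {k} i≢j i≢k j≢k = record
  { x = x ; x-inj = x-inj ; e = e ; joins = joins }
  where
  x : Fin 5 → Vertex
  x 0F = u i
  x 1F = v
  x 2F = u j
  x 3F = w
  x 4F = u k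

  x-inj : Injective _≡_ _≡_ x
  x-inj = injective-suc
    (λ { 0F → λ (); 1F → i≢j ∘ u-injective; 2F → λ (); 3F → i≢k ∘ u-injective })
    (injective-suc (λ { 0F → λ (); 1F → λ (); 2F → λ () })
    (injective-suc (λ { 0F → λ (); 1F → j≢k ∘ u-injective })
    (injective-suc (λ { 0F → λ () })
    (injective-fin1 _))))

  e : Fin 4 → Edge
  e 0F = vu i
  e 1F = vu j
  e 2F = wu j
  e 3F = wu k

  joins : ∀ t → Joins (e t) (x (inject₁ t)) (x (suc t))
  joins 0F = vu-uv i
  joins 1F = vu-vu j
  joins 2F = wu-uw j
  joins 3F = wu-wu k

∉-∷⁺ : ∀ {A : Set} {x y : A} {ys} → x ≢ y → x ∉ ys → x ∉ y ∷ ys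
∉-∷⁺ x≢y _ (here x≡y) = x≢y x≡y
∉-∷⁺ _ x∉ys (there x∈ys) = x∉ys x∈ys

record Complement (k : Fin 3) : Set where
  field
    i j : Fin 3
    i≢j : i ≢ j
    k≢i : k ≢ i
    k≢j : k ≢ j

complement : ∀ k → Complement k
complement 0F = record { i = 1F ; j = 2F ; i≢j = λ () ; k≢i = λ () ; k≢j = λ () }
complement 1F = record { i = 0F ; j = 2F ; i≢j = λ () ; k≢i = λ () ; k≢j = λ () }
complement 2F = record { i = 0F ; j = 1F ; i≢j = λ () ; k≢i = λ () ; k≢j = λ () }

module _ (c : Coloring) where

  wColours : List ℕ
  wColours = map (c ∘ wu) (allFin 3)

  Matched : Fin 3 → Set
  Matched i = ∃ λ j → c (vu i) ≡ c (wu j)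

  matched? : ∀ i → Dec (Matched i)
  matched? i = any? λ j → c (vu i) ≟ c (wu j)

  matched⇒∈ : ∀ {i} → Matched i → c (vu i) ∈ wColours
  matched⇒∈ (j , aᵢ≡bⱼ) = subst (_∈ wColours) (sym aᵢ≡bⱼ) (∈-map⁺ (c ∘ wu) (∈-allFin j))

  unmatched⇒∉ : ∀ {i} → ¬ Matched i → c (vu i) ∉ wColours
  unmatched⇒∉ unmatched aᵢ∈ with ∈-map⁻ (c ∘ wu) aᵢ∈
  ... | j , _ , aᵢ≡bⱼ = unmatched (j , aᵢ≡bⱼ)

module _ (c : Coloring) (proper : Proper c) where

  vColours-distinct : ∀ {i j} → i ≢ j → c (vu i) ≢ c (vu j)
  vColours-distinct i≢j = proper _ _ (at-v i≢j)

  wColours-distinct : ∀ {i j} → i ≢ j → c (wu i) ≢ c (wu j)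
  wColours-distinct i≢j = proper _ _ (at-w i≢j)

  colours-at-u-distinct : ∀ i → c (vu i) ≢ c (wu i)
  colours-at-u-distinct i = proper _ _ (at-u₁ i)

  zigzag-rainbow : ∀ {i j k} (i≢j : i ≢ j) (i≢k : i ≢ k) (j≢k : j ≢ k) →
    c (vu i) ≢ c (wu j) → c (vu i) ≢ c (wu k) → c (vu j) ≢ c (wu k) →
    Rainbow c (zigzag i≢j i≢k j≢k)
  zigzag-rainbow {j = j} i≢j i≢k j≢k aᵢ≢bⱼ aᵢ≢bₖ aⱼ≢bₖ = injective-suc
    (λ { 0F → vColours-distinct i≢j; 1F → aᵢ≢bⱼ; 2F → aᵢ≢bₖ })
    (injective-suc (λ { 0F → colours-at-u-distinct j; 1F → aⱼ≢bₖ })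
    (injective-suc (λ { 0F → wColours-distinct j≢k })
    (injective-fin1 _)))

  unmatched⇒swapped : ¬ Σ Path5 (Rainbow c) → ∀ {k i j} → ¬ Matched c k →
    k ≢ i → k ≢ j → i ≢ j → c (vu i) ≡ c (wu j)
  unmatched⇒swapped noRainbow {i = i} {j} unmatched k≢i k≢j i≢j =
    decidable-stable (c (vu i) ≟ c (wu j)) λ aᵢ≢bⱼ → noRainbow
      ( zigzag k≢i k≢j i≢j
      , zigzag-rainbow k≢i k≢j i≢j (unmatched ∘ (i ,_)) (unmatched ∘ (j ,_)) aᵢ≢bⱼ)

  wColours-unique : Unique (wColours c)
  wColours-unique = Unique.map⁺ bᵢ≡bⱼ⇒i≡j (Unique.allFin⁺ 3)
    where
    bᵢ≡bⱼ⇒i≡j : Injective _≡_ _≡_ (c ∘ wu)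
    bᵢ≡bⱼ⇒i≡j {i} {j} bᵢ≡bⱼ with i Fin.≟ j
    ... | yes i≡j = i≡j
    ... | no i≢j = ⊥-elim (wColours-distinct i≢j bᵢ≡bⱼ)

  private
    a : Fin 3 → ℕ
    a i = c (vu i)

    distinctCount-wColours : distinctCount (wColours c) ≡ 3
    distinctCount-wColours = distinctCount-unique wColours-unique

  -- numColors c unfolds to distinctCount (a 0F ∷ a 1F ∷ a 2F ∷ wColours c).
  numColors-allMatched : (∀ i → Matched c i) → numColors c ≡ 3
  numColors-allMatched m = begin
    distinctCount (a 0F ∷ a 1F ∷ a 2F ∷ wColours c) ≡⟨ distinctCount-∷-∈ (there (there (matched⇒∈ c (m 0F)))) ⟩
    distinctCount (a 1F ∷ a 2F ∷ wColours c)        ≡⟨ distinctCount-∷-∈ (there (matched⇒∈ c (m 1F))) ⟩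
    distinctCount (a 2F ∷ wColours c)               ≡⟨ distinctCount-∷-∈ (matched⇒∈ c (m 2F)) ⟩
    distinctCount (wColours c)                      ≡⟨ distinctCount-wColours ⟩
    3                                               ∎
    where open ≡-Reasoning

  numColors-oneUnmatched : ∀ k → ¬ Matched c k →
    let open Complement (complement k) in Matched c i → Matched c j → numColors c ≡ 4
  numColors-oneUnmatched 0F unmatched m₁ m₂ =
    trans (distinctCount-∷-∉ a₀∉)
      (cong Nat.suc (trans (distinctCount-∷-∈ (there (matched⇒∈ c m₁)))
        (trans (distinctCount-∷-∈ (matched⇒∈ c m₂)) distinctCount-wColours)))
    where
    a₀∉ : a 0F ∉ a 1F ∷ a 2F ∷ wColours c
    a₀∉ = ∉-∷⁺ (vColours-distinct λ ()) (∉-∷⁺ (vColours-distinct λ ()) (unmatched⇒∉ c unmatched))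
  numColors-oneUnmatched 1F unmatched m₀ m₂ =
    trans (distinctCount-∷-∈ (there (there (matched⇒∈ c m₀))))
      (trans (distinctCount-∷-∉ a₁∉)
        (cong Nat.suc (trans (distinctCount-∷-∈ (matched⇒∈ c m₂)) distinctCount-wColours)))
    where
    a₁∉ : a 1F ∉ a 2F ∷ wColours c
    a₁∉ = ∉-∷⁺ (vColours-distinct λ ()) (unmatched⇒∉ c unmatched)
  numColors-oneUnmatched 2F unmatched m₀ m₁ =
    trans (distinctCount-∷-∈ (there (there (matched⇒∈ c m₀))))
      (trans (distinctCount-∷-∈ (there (matched⇒∈ c m₁)))
        (trans (distinctCount-∷-∉ (unmatched⇒∉ c unmatched)) (cong Nat.suc distinctCount-wColours)))

lemma3 : (c : Coloring) → Proper c → ¬ (Σ Path5 (Rainbow c)) →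
    (numColors c ≡ 4 × Σ (Fin 3) (λ i → Σ (Fin 3) (λ j →
        i ≢ j × c (vu i) ≡ c (wu j) × c (vu j) ≡ c (wu i))))
    ⊎ (numColors c ≡ 3 × ((i : Fin 3) → ∃ (λ j → c (vu i) ≡ c (wu j))))
lemma3 c proper noRainbow with all? (matched? c)
... | yes allMatched = inj₂ (numColors-allMatched c proper allMatched , allMatched)
... | no notAllMatched with ¬∀⟶∃¬ 3 (Matched c) (matched? c) notAllMatched
... | k , unmatched =
  inj₁ (numColors-oneUnmatched c proper k unmatched (j , aᵢ≡bⱼ) (i , aⱼ≡bᵢ) , i , j , i≢j , aᵢ≡bⱼ , aⱼ≡bᵢ)
  where
  open Complement (complement k)
  aᵢ≡bⱼ : c (vu i) ≡ c (wu j)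
  aᵢ≡bⱼ = unmatched⇒swapped c proper noRainbow unmatched k≢i k≢j i≢j
  aⱼ≡bᵢ : c (vu j) ≡ c (wu i)
  aⱼ≡bᵢ = unmatched⇒swapped c proper noRainbow unmatched k≢j k≢i (i≢j ∘ sym)
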